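{- For every integer $n\geq 1$, $$2^{1-n}\sum_{a_0+a_1+\cdots+a_m=n}[a_0,a_1,\ldots,a_m]=\frac32-2^{ -n},$$ where the sum runs over all finite tuples $(a_0,a_1,\dots,a_m)$, $m\ge 0$, with $a_0\in\mathbb{N}\cup\{0\}$, $a_1,\dots,a_m\in\mathbb{N}$, $a_m\geq 2$ if $m\geq1$, and $a_0+\cdots+a_m=n$.
   Context: $[a_0,a_1,\ldots,a_m]$ denotes the finite regular continued fraction $a_0+\cfrac{1}{a_1+\cfrac{1}{\ddots+\cfrac{1}{a_m}}}$. With the normalization $a_m\ge2$ when $m\ge1$, every positive rational has exactly one such representation. $\mathbb{N}=\{1,2,3,\dots\}$. -}

module Defs where

open import Data.Nat as ℕ using (ℕ; zero; suc; _∸_; _^_)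
open import Data.Nat.Properties using (m^n≢0)
open import Data.Bool using (Bool; true; false; _∧_; if_then_else_)
open import Data.List using (List; []; _∷_; map; concatMap; upTo; filterᵇ; foldr; length)
open import Data.Nat.ListAction using (sum)
open import Data.Integer using (+_)
open import Data.Rational as ℚ using (ℚ; 0ℚ; 1ℚ; _+_; 1/_; _/_)
open import Data.Rational.Properties using (_≟_)
open import Relation.Nullary using (yes; no)

-- Total reciprocal on ℚ (1/0 := 0; never used on the relevant tuples,
-- whose tails always have value ≥ 1).
recip : ℚ → ℚ
recip p with p ≟ 0ℚ
... | yes _ = 0ℚ
... | no p≢0 = 1/_ p {{ℚ.≢-nonZero p≢0}}

cf : List ℕ → ℚ
cf []           = 0ℚ
cf (a ∷ [])     = + a / 1
cf (a ∷ b ∷ as) = (+ a / 1) + recip (cf (b ∷ as))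

inv2^ : ℕ → ℚ
inv2^ k = _/_ (+ 1) (2 ^ k) {{m^n≢0 2 k}}

allPos : List ℕ → Bool
allPos []       = true
allPos (x ∷ xs) = (1 ℕ.≤ᵇ x) ∧ allPos xs

lastGe2 : List ℕ → Bool
lastGe2 []       = true
lastGe2 (x ∷ []) = 2 ℕ.≤ᵇ x
lastGe2 (x ∷ y ∷ ys) = lastGe2 (y ∷ ys)

admissible : ℕ → List ℕ → Bool
admissible n []       = false
admissible n (a₀ ∷ as) = allPos as ∧ lastGe2 as ∧ (sum (a₀ ∷ as) ℕ.≡ᵇ n)

listsOver : ℕ → ℕ → List (List ℕ)
listsOver n zero    = [] ∷ []
listsOver n (suc k) = concatMap (λ x → map (x ∷_) (listsOver n k)) (upTo (suc n))

-- All lists of length 1, …, n+1 with entries in {0, …, n}.  Every admissible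
-- tuple for n lies here (entries ≤ n, and m ≤ n since a₁,…,a_m ≥ 1); each
-- list occurs exactly once.
candidates : ℕ → List (List ℕ)
candidates n = concatMap (λ k → listsOver n (suc k)) (upTo (suc n))

tuples : ℕ → List (List ℕ)
tuples n = filterᵇ (admissible n) (candidates n)

sumℚ : List ℚ → ℚ
sumℚ = foldr _+_ 0ℚ

cfSum : ℕ → ℚ
cfSum n = sumℚ (map cf (tuples n))

{-# OPTIONS --safe #-}

-- Split the admissible tuples of total n + 2 by their first entry a₀.
-- Raising a₀ by one maps the tuples of total n + 1 bijectively onto those
-- with a₀ ≥ 1 and adds 1 to each value, and prefixing a 0 maps the latter
-- bijectively onto those with a₀ = 0.  On the tuples with a₀ = 0 the
-- involution [0, 1, x, …] ↔ [0, x + 1, …] (fixing [0, 2]) pairs values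
-- summing to 1, because 1/(1 + 1/y) + 1/(1 + y) = 1.  So the number C n of
-- tuples doubles at each step, C n = 2ⁿ⁻¹, and the sum S n of their values
-- satisfies S (n + 2) = S (n + 1) + (3/2) C (n + 1).

module Submission where

open import Defs

open import Algebra.Bundles using (CommutativeMonoid)
open import Data.Bool using (Bool; true; false; not; T)
open import Data.Bool.Properties using (T-∧)
open import Data.Empty using (⊥-elim)
open import Data.Integer as ℤ using (ℤ; +_)
import Data.Integer.Properties as ℤ
open import Data.List using (List; []; _∷_; map; concatMap; upTo; filterᵇ; length)
open import Data.List.Membership.Propositional using (_∈_; lose)
open import Data.List.Membership.Propositional.Properties
  using (∈-map⁺; ∈-map⁻; ∈-filter⁺; ∈-filter⁻; ∈-concatMap⁺; ∈-concatMap⁻; ∈-upTo⁺)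
open import Data.List.Membership.Propositional.Properties.WithK using (unique∧set⇒bag)
open import Data.List.Properties using (map-∘; ∷-injectiveʳ)
open import Data.List.Relation.Binary.BagAndSetEquality using (_∼[_]_; set; ∼bag⇒↭)
open import Data.List.Relation.Binary.Disjoint.Propositional using (Disjoint)
open import Data.List.Relation.Binary.Permutation.Propositional using (_↭_; ↭⇒↭ₛ)
import Data.List.Relation.Binary.Permutation.Propositional.Properties as ↭
open import Data.List.Relation.Binary.Permutation.Setoid.Properties using (foldr-commMonoid)
open import Data.List.Relation.Unary.All as All using (All; []; _∷_)
import Data.List.Relation.Unary.All.Properties as All
open import Data.List.Relation.Unary.AllPairs as AllPairs using ([]; _∷_)
import Data.List.Relation.Unary.AllPairs.Properties as AllPairs
open import Data.List.Relation.Unary.Any using (here; there; satisfied)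
open import Data.List.Relation.Unary.Unique.Propositional using (Unique)
import Data.List.Relation.Unary.Unique.Propositional.Properties as Unique
open import Data.Nat as ℕ using (ℕ; zero; suc; _∸_; _≤_; z≤n; s≤s; NonZero)
open import Data.Nat.ListAction using (sum)
open import Data.Nat.Properties
  using (≤-trans; m≤m+n; m≤n+m; +-identityʳ; suc-injective; ≡ᵇ⇒≡; ≡⇒≡ᵇ; m*n≢0; m^n≢0)
open import Data.Product using (_×_; _,_; proj₂)
open import Data.Rational as ℚ using (ℚ; 0ℚ; 1ℚ; ½; _+_; _*_; _-_; _/_; 1/_; Positive)
open import Data.Rational.Properties as ℚ
  using (_≟_; fromℚᵘ-cong; toℚᵘ-injective; toℚᵘ-fromℚᵘ; toℚᵘ-homo-+; toℚᵘ-homo-*;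
         pos⇒nonZero; positive⁻¹; <-irrefl; normalize-pos; pos+pos⇒pos; 1/pos⇒pos;
         *-inverseˡ; *-inverseʳ; *-identityˡ; *-identityʳ; *-assoc; +-assoc; +-comm; +-identityˡ)
open import Data.Rational.Solver using (module +-*-Solver)
open import Data.Rational.Unnormalised as ℚᵘ using (ℚᵘ; mkℚᵘ; *≡*)
import Data.Rational.Unnormalised.Properties as ℚᵘ
open import Function using (_∘_; const; Equivalence; mk⇔)
open import Relation.Binary.PropositionalEquality
  using (_≡_; refl; sym; trans; cong; cong₂; subst; module ≡-Reasoning)
open import Relation.Nullary using (yes; no; ¬_)
open import Relation.Nullary.Decidable using (T?)

open +-*-Solver using (solve; _:+_; _:*_; _:-_; _:=_; con)

private
  variable
    A B : Set
    a b n : ℕ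
    r : List ℕ

data Tail : List ℕ → Set where
  empty : Tail []
  last  : ∀ a → Tail (suc (suc a) ∷ [])
  cons  : ∀ a {b r} → Tail (b ∷ r) → Tail (suc a ∷ b ∷ r)

data Admissible (n : ℕ) : List ℕ → Set where
  adm : ∀ a {r} → Tail r → a ℕ.+ sum r ≡ n → Admissible n (a ∷ r)

Tail-uncons : Tail (b ∷ r) → Tail r
Tail-uncons (last _)   = empty
Tail-uncons (cons _ t) = t

Tail⇒allPos : Tail r → T (allPos r)
Tail⇒allPos empty      = _
Tail⇒allPos (last _)   = _
Tail⇒allPos (cons _ t) = Tail⇒allPos t

Tail⇒lastGe2 : Tail r → T (lastGe2 r)
Tail⇒lastGe2 empty      = _
Tail⇒lastGe2 (last _)   = _
Tail⇒lastGe2 (cons _ t) = Tail⇒lastGe2 t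

allPos∧lastGe2⇒Tail : ∀ r → T (allPos r) → T (lastGe2 r) → Tail r
allPos∧lastGe2⇒Tail []                   _ _ = empty
allPos∧lastGe2⇒Tail (suc (suc a) ∷ [])   _ _ = last a
allPos∧lastGe2⇒Tail (suc a ∷ b ∷ r)      p q = cons a (allPos∧lastGe2⇒Tail (b ∷ r) p q)
allPos∧lastGe2⇒Tail (zero ∷ _)           () _
allPos∧lastGe2⇒Tail (suc zero ∷ [])      _ ()

admissible⇒Admissible : ∀ n t → T (admissible n t) → Admissible n t
admissible⇒Admissible n (a ∷ r) h =
  let pos , rest = Equivalence.to (T-∧ {allPos r}) h
      ge2 , total = Equivalence.to (T-∧ {lastGe2 r}) rest
  in adm a (allPos∧lastGe2⇒Tail r pos ge2) (≡ᵇ⇒≡ (a ℕ.+ sum r) n total)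

Admissible⇒admissible : ∀ {t} → Admissible n t → T (admissible n t)
Admissible⇒admissible (adm a {r} t refl) =
  Equivalence.from T-∧
    (Tail⇒allPos t , Equivalence.from T-∧ (Tail⇒lastGe2 t , ≡⇒≡ᵇ (a ℕ.+ sum r) _ refl))

length≤sum : Tail r → length r ≤ sum r
length≤sum empty               = z≤n
length≤sum (last _)            = s≤s z≤n
length≤sum (cons a {b} {r} t)  = s≤s (≤-trans (length≤sum t) (m≤n+m (sum (b ∷ r)) a))

All≤sum : ∀ xs → All (_≤ sum xs) xs
All≤sum []       = []
All≤sum (x ∷ xs) =
  m≤m+n x (sum xs) ∷ All.map (λ y≤ → ≤-trans y≤ (m≤n+m (sum xs) x)) (All≤sum xs)

∈-listsOver : ∀ {xs} → All (_≤ n) xs → xs ∈ listsOver n (length xs)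
∈-listsOver []                          = here refl
∈-listsOver {n} {x ∷ xs} (x≤n ∷ xs≤n) =
  ∈-concatMap⁺ (λ y → map (y ∷_) (listsOver n (length xs)))
    (lose (∈-upTo⁺ (s≤s x≤n)) (∈-map⁺ (x ∷_) (∈-listsOver xs≤n)))

length-∈-listsOver : ∀ n k {xs} → xs ∈ listsOver n k → length xs ≡ k
length-∈-listsOver n zero    (here refl) = refl
length-∈-listsOver n (suc k) p
  with _ , q ← satisfied (∈-concatMap⁻ _ {xs = upTo (suc n)} p)
  with _ , ys∈ , refl ← ∈-map⁻ _ q
  = cong suc (length-∈-listsOver n k ys∈)

∈-candidates : ∀ {t} → Admissible n t → t ∈ candidates n
∈-candidates (adm a {r} t refl) =
  ∈-concatMap⁺ (λ k → listsOver (a ℕ.+ sum r) (suc k))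
    (lose (∈-upTo⁺ (s≤s (≤-trans (length≤sum t) (m≤n+m (sum r) a))))
          (∈-listsOver (All≤sum (a ∷ r))))

∈-tuples⁻ : ∀ {t} → t ∈ tuples n → Admissible n t
∈-tuples⁻ {n} {t} p =
  admissible⇒Admissible n t (proj₂ (∈-filter⁻ (T? ∘ admissible n) {xs = candidates n} p))

∈-tuples⁺ : ∀ {t} → Admissible n t → t ∈ tuples n
∈-tuples⁺ a = ∈-filter⁺ (T? ∘ admissible _) (∈-candidates a) (Admissible⇒admissible a)

concatMap-unique : ∀ (f : A → List B) {xs} → (∀ x → Unique (f x)) →
                   (∀ {x y} → ¬ x ≡ y → Disjoint (f x) (f y)) →
                   Unique xs → Unique (concatMap f xs)
concatMap-unique f {xs} f-unique f-disjoint xs-unique =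
  Unique.concat⁺ (All.map⁺ (All.universal f-unique xs))
                 (AllPairs.map⁺ (AllPairs.map f-disjoint xs-unique))

listsOver-unique : ∀ n k → Unique (listsOver n k)
listsOver-unique n zero    = [] ∷ []
listsOver-unique n (suc k) =
  concatMap-unique _ (λ _ → Unique.map⁺ ∷-injectiveʳ (listsOver-unique n k)) heads-differ
    (Unique.upTo⁺ (suc n))
  where
  heads-differ : ∀ {x y} → ¬ x ≡ y →
                 Disjoint (map (x ∷_) (listsOver n k)) (map (y ∷_) (listsOver n k))
  heads-differ x≢y (p , q)
    with _ , _ , refl ← ∈-map⁻ _ p
    with _ , _ , refl ← ∈-map⁻ _ q
    = x≢y refl

tuples-unique : ∀ n → Unique (tuples n)
tuples-unique n = Unique.filter⁺ (T? ∘ admissible n)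
  (concatMap-unique _ (λ k → listsOver-unique n (suc k)) lengths-differ (Unique.upTo⁺ (suc n)))
  where
  lengths-differ : ∀ {x y} → ¬ x ≡ y → Disjoint (listsOver n (suc x)) (listsOver n (suc y))
  lengths-differ x≢y (p , q) =
    x≢y (suc-injective (trans (sym (length-∈-listsOver n _ p)) (length-∈-listsOver n _ q)))

sumOf : (A → ℚ) → List A → ℚ
sumOf f xs = sumℚ (map f xs)

private module ℚ+ = CommutativeMonoid ℚ.+-0-commutativeMonoid

open import Algebra.Properties.CommutativeSemigroup ℚ+.commutativeSemigroup
  using (interchange; x∙yz≈y∙xz)

sumOf-↭ : ∀ (f : A → ℚ) {xs ys} → xs ↭ ys → sumOf f xs ≡ sumOf f ys
sumOf-↭ f xs↭ys =
  foldr-commMonoid ℚ+.setoid ℚ+.isCommutativeMonoid (↭⇒↭ₛ (↭.map⁺ f xs↭ys))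

sumOf-reindex : ∀ (f : B → ℚ) {h : A → B} → (∀ {x y} → h x ≡ h y → x ≡ y) →
                ∀ {xs ys} → Unique xs → Unique ys → xs ∼[ set ] map h ys →
                sumOf f xs ≡ sumOf (f ∘ h) ys
sumOf-reindex f {h} h-injective {xs} {ys} xs-unique ys-unique xs∼hys = begin
  sumOf f xs           ≡⟨ sumOf-↭ f (∼bag⇒↭ (unique∧set⇒bag xs-unique hys-unique xs∼hys)) ⟩
  sumOf f (map h ys)   ≡⟨ cong sumℚ (sym (map-∘ ys)) ⟩
  sumOf (f ∘ h) ys     ∎
  where
  open ≡-Reasoning
  hys-unique = Unique.map⁺ h-injective ys-unique

sumOf-involution : ∀ (f : A → ℚ) (g : A → A) → (∀ x → g (g x) ≡ x) → ∀ {xs} → Unique xs →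
                   (∀ {x} → x ∈ xs → g x ∈ xs) → sumOf f xs ≡ sumOf (f ∘ g) xs
sumOf-involution f g g-involutive {xs} xs-unique g-closed =
  sumOf-reindex f g-injective xs-unique xs-unique (mk⇔ to from)
  where
  g-injective : ∀ {x y} → g x ≡ g y → x ≡ y
  g-injective {x} {y} gx≡gy =
    trans (sym (g-involutive x)) (trans (cong g gx≡gy) (g-involutive y))
  to : ∀ {x} → x ∈ xs → x ∈ map g xs
  to {x} x∈ = subst (_∈ map g xs) (g-involutive x) (∈-map⁺ g (g-closed x∈))
  from : ∀ {x} → x ∈ map g xs → x ∈ xs
  from x∈ with _ , y∈ , refl ← ∈-map⁻ g x∈ = g-closed y∈

sumOf-cong : ∀ {f g : A → ℚ} xs → (∀ {x} → x ∈ xs → f x ≡ g x) → sumOf f xs ≡ sumOf g xs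
sumOf-cong []       _   = refl
sumOf-cong (x ∷ xs) f≡g = cong₂ _+_ (f≡g (here refl)) (sumOf-cong xs (f≡g ∘ there))

sumOf-+ : ∀ (f g : A → ℚ) xs → sumOf (λ x → f x + g x) xs ≡ sumOf f xs + sumOf g xs
sumOf-+ f g []       = refl
sumOf-+ f g (x ∷ xs) =
  trans (cong (_+_ (f x + g x)) (sumOf-+ f g xs))
        (interchange (f x) (g x) (sumOf f xs) (sumOf g xs))

sumOf-partition : ∀ (f : A → ℚ) (p : A → Bool) xs →
                  sumOf f xs ≡ sumOf f (filterᵇ (not ∘ p) xs) + sumOf f (filterᵇ p xs)
sumOf-partition f p []       = refl
sumOf-partition f p (x ∷ xs) with p x
... | true  = trans (cong (_+_ (f x)) (sumOf-partition f p xs)) (x∙yz≈y∙xz (f x) rejected _)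
  where rejected = sumOf f (filterᵇ (not ∘ p) xs)
... | false = trans (cong (_+_ (f x)) (sumOf-partition f p xs)) (sym (+-assoc (f x) rejected _))
  where rejected = sumOf f (filterᵇ (not ∘ p) xs)

-- Continued fractions

fromℚᵘ-homo-+ : ∀ (p q : ℚᵘ) → ℚ.fromℚᵘ (p ℚᵘ.+ q) ≡ ℚ.fromℚᵘ p + ℚ.fromℚᵘ q
fromℚᵘ-homo-+ p q = toℚᵘ-injective (ℚᵘ.≃-trans (toℚᵘ-fromℚᵘ (p ℚᵘ.+ q)) (ℚᵘ.≃-sym
  (ℚᵘ.≃-trans (toℚᵘ-homo-+ (ℚ.fromℚᵘ p) (ℚ.fromℚᵘ q)) (ℚᵘ.+-cong (toℚᵘ-fromℚᵘ p) (toℚᵘ-fromℚᵘ q)))))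

fromℚᵘ-homo-* : ∀ (p q : ℚᵘ) → ℚ.fromℚᵘ (p ℚᵘ.* q) ≡ ℚ.fromℚᵘ p * ℚ.fromℚᵘ q
fromℚᵘ-homo-* p q = toℚᵘ-injective (ℚᵘ.≃-trans (toℚᵘ-fromℚᵘ (p ℚᵘ.* q)) (ℚᵘ.≃-sym
  (ℚᵘ.≃-trans (toℚᵘ-homo-* (ℚ.fromℚᵘ p) (ℚ.fromℚᵘ q)) (ℚᵘ.*-cong (toℚᵘ-fromℚᵘ p) (toℚᵘ-fromℚᵘ q)))))

/1-homo-+ : ∀ (i j : ℤ) → (i ℤ.+ j) / 1 ≡ i / 1 + j / 1
/1-homo-+ i j =
  trans (fromℚᵘ-cong {mkℚᵘ (i ℤ.+ j) 0} {mkℚᵘ i 0 ℚᵘ.+ mkℚᵘ j 0} (*≡* cross-multiplied))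
        (fromℚᵘ-homo-+ (mkℚᵘ i 0) (mkℚᵘ j 0))
  where
  cross-multiplied : (i ℤ.+ j) ℤ.* + 1 ≡ (i ℤ.* + 1 ℤ.+ j ℤ.* + 1) ℤ.* + 1
  cross-multiplied = trans (ℤ.*-identityʳ _)
    (sym (trans (ℤ.*-identityʳ _) (cong₂ ℤ._+_ (ℤ.*-identityʳ i) (ℤ.*-identityʳ j))))

1/[m*n]≡1/m*1/n : ∀ m n .{{_ : NonZero m}} .{{_ : NonZero n}} →
          (+ 1 / (m ℕ.* n)) {{m*n≢0 m n}} ≡ (+ 1 / m) * (+ 1 / n)
1/[m*n]≡1/m*1/n (suc m) (suc n) = fromℚᵘ-homo-* (mkℚᵘ (+ 1) m) (mkℚᵘ (+ 1) n)

inv2^-suc : ∀ k → inv2^ (suc k) ≡ ½ * inv2^ k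
inv2^-suc k = 1/[m*n]≡1/m*1/n 2 (2 ℕ.^ k) {{_}} {{m^n≢0 2 k}}

recip-pos : ∀ p .{{_ : Positive p}} → recip p ≡ (1/ p) {{pos⇒nonZero p}}
recip-pos p with p ≟ 0ℚ
... | yes p≡0 = ⊥-elim (<-irrefl (sym p≡0) (positive⁻¹ p))
... | no  _   = refl

*-inverseʳ-unique : ∀ p q .{{_ : ℚ.NonZero p}} → p * q ≡ 1ℚ → q ≡ 1/ p
*-inverseʳ-unique p q pq≡1 = begin
  q              ≡⟨ sym (*-identityˡ q) ⟩
  1ℚ * q         ≡⟨ cong (_* q) (sym (*-inverseˡ p)) ⟩
  (1/ p * p) * q ≡⟨ *-assoc (1/ p) p q ⟩
  1/ p * (p * q) ≡⟨ cong (1/ p *_) pq≡1 ⟩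
  1/ p * 1ℚ      ≡⟨ *-identityʳ (1/ p) ⟩
  1/ p           ∎
  where open ≡-Reasoning

recip[1+1/y]+recip[1+y]≡1 : ∀ y .{{_ : Positive y}} →
                            recip (1ℚ + recip y) + recip (1ℚ + y) ≡ 1ℚ
recip[1+1/y]+recip[1+y]≡1 y =
  let instance
        y≢0 : ℚ.NonZero y
        y≢0 = pos⇒nonZero y
        1/y>0 : Positive (1/ y)
        1/y>0 = 1/pos⇒pos y
        1+1/y>0 : Positive (1ℚ + 1/ y)
        1+1/y>0 = pos+pos⇒pos 1ℚ (1/ y)
        1+y>0 : Positive (1ℚ + y)
        1+y>0 = pos+pos⇒pos 1ℚ y
        1+1/y≢0 : ℚ.NonZero (1ℚ + 1/ y)
        1+1/y≢0 = pos⇒nonZero (1ℚ + 1/ y)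
        1+y≢0 : ℚ.NonZero (1ℚ + y)
        1+y≢0 = pos⇒nonZero (1ℚ + y)
      w = 1/ (1ℚ + y)
      1/[1+1/y]≡yw : 1/ (1ℚ + 1/ y) ≡ y * w
      1/[1+1/y]≡yw = sym (*-inverseʳ-unique (1ℚ + 1/ y) (y * w) (begin
        (1ℚ + 1/ y) * (y * w)
          ≡⟨ solve 3 (λ u y w → (con 1ℚ :+ u) :* (y :* w) := (y :* u :+ y) :* w) refl (1/ y) y w ⟩
        (y * 1/ y + y) * w
          ≡⟨ cong (λ z → (z + y) * w) (*-inverseʳ y) ⟩
        (1ℚ + y) * w
          ≡⟨ *-inverseʳ (1ℚ + y) ⟩
        1ℚ ∎))
  in begin
    recip (1ℚ + recip y) + recip (1ℚ + y)
      ≡⟨ cong (λ z → recip (1ℚ + z) + recip (1ℚ + y)) (recip-pos y) ⟩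
    recip (1ℚ + 1/ y) + recip (1ℚ + y)
      ≡⟨ cong₂ _+_ (recip-pos (1ℚ + 1/ y)) (recip-pos (1ℚ + y)) ⟩
    1/ (1ℚ + 1/ y) + w
      ≡⟨ cong (_+ w) 1/[1+1/y]≡yw ⟩
    y * w + w
      ≡⟨ solve 2 (λ y w → y :* w :+ w := (con 1ℚ :+ y) :* w) refl y w ⟩
    (1ℚ + y) * w
      ≡⟨ *-inverseʳ (1ℚ + y) ⟩
    1ℚ ∎
  where open ≡-Reasoning

cf-suc : ∀ a r → cf (suc a ∷ r) ≡ 1ℚ + cf (a ∷ r)
cf-suc a []      = /1-homo-+ (+ 1) (+ a)
cf-suc a (b ∷ r) =
  trans (cong (_+ recip (cf (b ∷ r))) (/1-homo-+ (+ 1) (+ a))) (+-assoc 1ℚ (+ a / 1) (recip (cf (b ∷ r))))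

cf-positive : Tail (b ∷ r) → Positive (cf (b ∷ r))
cf-positive (last a)             = normalize-pos (suc (suc a)) 1
cf-positive (cons a {c} {r} t) =
  let instance
        x>0 : Positive (cf (c ∷ r))
        x>0 = cf-positive t
        x≢0 : ℚ.NonZero (cf (c ∷ r))
        x≢0 = pos⇒nonZero (cf (c ∷ r))
        a>0 : Positive (+ suc a / 1)
        a>0 = normalize-pos (suc a) 1
        1/x>0 : Positive (1/ cf (c ∷ r))
        1/x>0 = 1/pos⇒pos (cf (c ∷ r))
  in subst (λ z → Positive ((+ suc a / 1) + z)) (sym (recip-pos (cf (c ∷ r))))
       (pos+pos⇒pos (+ suc a / 1) (1/ cf (c ∷ r)))

cf[0,1,x]+cf[0,1+x]≡1 : Tail (b ∷ r) → cf (0 ∷ 1 ∷ b ∷ r) + cf (0 ∷ suc b ∷ r) ≡ 1ℚ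
cf[0,1,x]+cf[0,1+x]≡1 {b} {r} t =
  let instance
        x>0 : Positive (cf (b ∷ r))
        x>0 = cf-positive t
  in begin
    (0ℚ + recip (1ℚ + recip x)) + (0ℚ + recip (cf (suc b ∷ r)))
      ≡⟨ cong₂ _+_ (+-identityˡ (recip (1ℚ + recip x)))
                     (trans (+-identityˡ (recip (cf (suc b ∷ r)))) (cong recip (cf-suc b r))) ⟩
    recip (1ℚ + recip x) + recip (1ℚ + x)
      ≡⟨ recip[1+1/y]+recip[1+y]≡1 x ⟩
    1ℚ ∎
  where
  open ≡-Reasoning
  x = cf (b ∷ r)

-- An involution on the tuples with a₀ = 0

-- [1, 1] is not a tail; fixing it makes complementTail an involution on all lists.
complementTail : List ℕ → List ℕ
complementTail (1 ∷ 1 ∷ [])      = 1 ∷ 1 ∷ []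
complementTail (2 ∷ [])          = 2 ∷ []
complementTail (1 ∷ suc b ∷ r)   = suc (suc b) ∷ r
complementTail (suc (suc b) ∷ r) = 1 ∷ suc b ∷ r
complementTail r                 = r

complementTail-involutive : ∀ r → complementTail (complementTail r) ≡ r
complementTail-involutive []                          = refl
complementTail-involutive (0 ∷ _)                     = refl
complementTail-involutive (1 ∷ [])                    = refl
complementTail-involutive (1 ∷ 0 ∷ _)                 = refl
complementTail-involutive (1 ∷ 1 ∷ [])                = refl
complementTail-involutive (1 ∷ 1 ∷ _ ∷ _)             = refl
complementTail-involutive (1 ∷ suc (suc _) ∷ _)       = refl
complementTail-involutive (2 ∷ [])                    = refl
complementTail-involutive (2 ∷ _ ∷ _)                 = refl
complementTail-involutive (suc (suc (suc _)) ∷ _)     = refl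

sum-complementTail : ∀ r → sum (complementTail r) ≡ sum r
sum-complementTail []                      = refl
sum-complementTail (0 ∷ _)                 = refl
sum-complementTail (1 ∷ [])                = refl
sum-complementTail (1 ∷ 0 ∷ _)             = refl
sum-complementTail (1 ∷ 1 ∷ [])            = refl
sum-complementTail (1 ∷ 1 ∷ _ ∷ _)         = refl
sum-complementTail (1 ∷ suc (suc _) ∷ _)   = refl
sum-complementTail (2 ∷ [])                = refl
sum-complementTail (2 ∷ _ ∷ _)             = refl
sum-complementTail (suc (suc (suc _)) ∷ _) = refl

complementTail-Tail : Tail r → Tail (complementTail r)
complementTail-Tail empty                             = empty
complementTail-Tail (last zero)                       = last zero
complementTail-Tail (last (suc a))                    = cons 0 (last a)
complementTail-Tail (cons zero (last a))              = last (suc a)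
complementTail-Tail (cons zero (cons zero t))         = cons 1 t
complementTail-Tail (cons zero (cons (suc b) t))      = cons (suc (suc b)) t
complementTail-Tail (cons 1 t)                        = cons 0 (cons 0 t)
complementTail-Tail (cons (suc (suc a)) t)            = cons 0 (cons (suc a) t)

cf-complementTail : Tail (b ∷ r) → cf (0 ∷ b ∷ r) + cf (0 ∷ complementTail (b ∷ r)) ≡ 1ℚ
cf-complementTail (last zero)            = refl
cf-complementTail (last (suc a))         =
  trans (+-comm (cf (0 ∷ suc (suc (suc a)) ∷ [])) _) (cf[0,1,x]+cf[0,1+x]≡1 (last a))
cf-complementTail (cons zero t@(last _))   = cf[0,1,x]+cf[0,1+x]≡1 t
cf-complementTail (cons zero t@(cons zero _))    = cf[0,1,x]+cf[0,1+x]≡1 t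
cf-complementTail (cons zero t@(cons (suc _) _)) = cf[0,1,x]+cf[0,1+x]≡1 t
cf-complementTail (cons 1 {b} {r} t) =
  trans (+-comm (cf (0 ∷ 2 ∷ b ∷ r)) _) (cf[0,1,x]+cf[0,1+x]≡1 (cons 0 t))
cf-complementTail (cons (suc (suc a)) {b} {r} t) =
  trans (+-comm (cf (0 ∷ suc (suc (suc a)) ∷ b ∷ r)) _) (cf[0,1,x]+cf[0,1+x]≡1 (cons (suc a) t))

complement : List ℕ → List ℕ
complement []      = []
complement (a ∷ r) = a ∷ complementTail r

complement-involutive : ∀ t → complement (complement t) ≡ t
complement-involutive []      = refl
complement-involutive (a ∷ r) = cong (a ∷_) (complementTail-involutive r)

headIsZero : List ℕ → Bool
headIsZero (zero ∷ _) = true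
headIsZero _          = false

zeroHeaded positiveHeaded : ℕ → List (List ℕ)
zeroHeaded     n = filterᵇ headIsZero (tuples n)
positiveHeaded n = filterᵇ (not ∘ headIsZero) (tuples n)

module _ (p : List ℕ → Bool) where

  ∈-filterTuples⁻ : ∀ n {t} → t ∈ filterᵇ p (tuples n) → Admissible n t × T (p t)
  ∈-filterTuples⁻ n t∈ with t∈′ , pt ← ∈-filter⁻ (T? ∘ p) {xs = tuples n} t∈ =
    ∈-tuples⁻ {n} t∈′ , pt

  ∈-filterTuples⁺ : ∀ n {t} → Admissible n t → T (p t) → t ∈ filterᵇ p (tuples n)
  ∈-filterTuples⁺ _ a pt = ∈-filter⁺ (T? ∘ p) (∈-tuples⁺ a) pt

  filterTuples-unique : ∀ n → Unique (filterᵇ p (tuples n))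
  filterTuples-unique n = Unique.filter⁺ (T? ∘ p) (tuples-unique n)

sucHead : List ℕ → List ℕ
sucHead []      = []
sucHead (a ∷ r) = suc a ∷ r

sucHead-injective : ∀ {s t} → sucHead s ≡ sucHead t → s ≡ t
sucHead-injective {[]}    {[]}    _    = refl
sucHead-injective {_ ∷ _} {_ ∷ _} refl = refl

sumOf-positiveHeaded : ∀ (f : List ℕ → ℚ) n →
                       sumOf f (positiveHeaded (suc n)) ≡ sumOf (f ∘ sucHead) (tuples n)
sumOf-positiveHeaded f n =
  sumOf-reindex f sucHead-injective (filterTuples-unique (not ∘ headIsZero) (suc n)) (tuples-unique n)
    (mk⇔ to from)
  where
  to : ∀ {t} → t ∈ positiveHeaded (suc n) → t ∈ map sucHead (tuples n)
  to t∈ with ∈-filterTuples⁻ (not ∘ headIsZero) (suc n) t∈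
  ... | adm (suc a) t eq , _ = ∈-map⁺ sucHead (∈-tuples⁺ (adm a t (suc-injective eq)))
  from : ∀ {t} → t ∈ map sucHead (tuples n) → t ∈ positiveHeaded (suc n)
  from t∈ with _ , s∈ , refl ← ∈-map⁻ sucHead t∈ with adm a t eq ← ∈-tuples⁻ {n} s∈ =
    ∈-filterTuples⁺ (not ∘ headIsZero) (suc n) (adm (suc a) t (cong suc eq)) _

Admissible⇒Tail : ∀ {a r} → Admissible (suc (suc n)) (suc a ∷ r) → Tail (suc a ∷ r)
Admissible⇒Tail {a = a} (adm _ {[]} _ eq)
  with refl ← suc-injective (trans (sym (+-identityʳ (suc a))) eq) = last _
Admissible⇒Tail (adm _ {_ ∷ _} t _) = cons _ t

Tail⇒positiveHead : Tail (b ∷ r) → T (not (headIsZero (b ∷ r)))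
Tail⇒positiveHead (last _)   = _
Tail⇒positiveHead (cons _ _) = _

sumOf-zeroHeaded : ∀ (f : List ℕ → ℚ) n →
                   sumOf f (zeroHeaded (suc (suc n))) ≡
                   sumOf (f ∘ (0 ∷_)) (positiveHeaded (suc (suc n)))
sumOf-zeroHeaded f n =
  sumOf-reindex f ∷-injectiveʳ
    (filterTuples-unique headIsZero N) (filterTuples-unique (not ∘ headIsZero) N) (mk⇔ to from)
  where
  N = suc (suc n)
  to : ∀ {t} → t ∈ zeroHeaded N → t ∈ map (0 ∷_) (positiveHeaded N)
  to t∈ with ∈-filterTuples⁻ headIsZero N t∈
  ... | adm zero {_ ∷ _} t eq , _ =
    ∈-map⁺ (0 ∷_)
      (∈-filterTuples⁺ (not ∘ headIsZero) N (adm _ (Tail-uncons t) eq) (Tail⇒positiveHead t))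
  from : ∀ {t} → t ∈ map (0 ∷_) (positiveHeaded N) → t ∈ zeroHeaded N
  from t∈ with _ , s∈ , refl ← ∈-map⁻ (0 ∷_) t∈ with ∈-filterTuples⁻ (not ∘ headIsZero) N s∈
  ... | a@(adm (suc _) _ eq) , _ = ∈-filterTuples⁺ headIsZero N (adm 0 (Admissible⇒Tail a) eq) _

sumOf-zeroHeaded-complement : ∀ (f : List ℕ → ℚ) n →
                              sumOf f (zeroHeaded n) ≡ sumOf (f ∘ complement) (zeroHeaded n)
sumOf-zeroHeaded-complement f n =
  sumOf-involution f complement complement-involutive (filterTuples-unique headIsZero n) complement-closed
  where
  complement-closed : ∀ {t} → t ∈ zeroHeaded n → complement t ∈ zeroHeaded n
  complement-closed t∈ with ∈-filterTuples⁻ headIsZero n t∈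
  ... | adm zero {r} t eq , _ =
    ∈-filterTuples⁺ headIsZero n (adm 0 (complementTail-Tail t) (trans (sum-complementTail r) eq)) _

sumOf-cf-zeroHeaded : ∀ n → sumOf cf (zeroHeaded (suc n)) + sumOf cf (zeroHeaded (suc n)) ≡
                            sumOf (const 1ℚ) (zeroHeaded (suc n))
sumOf-cf-zeroHeaded n = begin
  sumOf cf Z + sumOf cf Z                     ≡⟨ cong (_+_ (sumOf cf Z)) (sumOf-zeroHeaded-complement cf (suc n)) ⟩
  sumOf cf Z + sumOf (cf ∘ complement) Z      ≡⟨ sym (sumOf-+ cf (cf ∘ complement) Z) ⟩
  sumOf (λ t → cf t + cf (complement t)) Z    ≡⟨ sumOf-cong Z pairs-to-1 ⟩
  sumOf (const 1ℚ) Z                            ∎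
  where
  open ≡-Reasoning
  Z = zeroHeaded (suc n)
  pairs-to-1 : ∀ {t} → t ∈ Z → cf t + cf (complement t) ≡ 1ℚ
  pairs-to-1 t∈ with ∈-filterTuples⁻ headIsZero (suc n) t∈
  ... | adm zero {_ ∷ _} t _ , _ = cf-complementTail t

-- The recurrences and their solution

tupleCount : ℕ → ℚ
tupleCount n = sumOf (const 1ℚ) (tuples n)

tupleCount-zeroHeaded : ∀ n → sumOf (const 1ℚ) (zeroHeaded (suc (suc n))) ≡ tupleCount (suc n)
tupleCount-zeroHeaded n =
  trans (sumOf-zeroHeaded (const 1ℚ) n) (sumOf-positiveHeaded (const 1ℚ) (suc n))

tupleCount-suc : ∀ n → tupleCount (suc (suc n)) ≡ tupleCount (suc n) + tupleCount (suc n)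
tupleCount-suc n =
  trans (sumOf-partition (const 1ℚ) headIsZero (tuples (suc (suc n))))
        (cong₂ _+_ (sumOf-positiveHeaded (const 1ℚ) (suc n)) (tupleCount-zeroHeaded n))

cfSum-positiveHeaded : ∀ n → sumOf cf (positiveHeaded (suc n)) ≡ tupleCount n + cfSum n
cfSum-positiveHeaded n = begin
  sumOf cf (positiveHeaded (suc n))               ≡⟨ sumOf-positiveHeaded cf n ⟩
  sumOf (cf ∘ sucHead) (tuples n)                 ≡⟨ sumOf-cong (tuples n) cf-sucHead ⟩
  sumOf (λ t → 1ℚ + cf t) (tuples n)            ≡⟨ sumOf-+ (const 1ℚ) cf (tuples n) ⟩
  tupleCount n + cfSum n                        ∎
  where
  open ≡-Reasoning
  cf-sucHead : ∀ {t} → t ∈ tuples n → cf (sucHead t) ≡ 1ℚ + cf t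
  cf-sucHead t∈ with adm a {r} _ _ ← ∈-tuples⁻ {n} t∈ = cf-suc a r

cfSum-zeroHeaded : ∀ n → sumOf cf (zeroHeaded (suc (suc n))) ≡ ½ * tupleCount (suc n)
cfSum-zeroHeaded n = begin
  z                  ≡⟨ solve 1 (λ z → z := con ½ :* (z :+ z)) refl z ⟩
  ½ * (z + z)      ≡⟨ cong (½ *_) (trans (sumOf-cf-zeroHeaded (suc n)) (tupleCount-zeroHeaded n)) ⟩
  ½ * tupleCount (suc n) ∎
  where
  open ≡-Reasoning
  z = sumOf cf (zeroHeaded (suc (suc n)))

cfSum-suc : ∀ n → cfSum (suc (suc n)) ≡ cfSum (suc n) + (+ 3 / 2) * tupleCount (suc n)
cfSum-suc n = begin
  cfSum (suc (suc n))
    ≡⟨ sumOf-partition cf headIsZero (tuples (suc (suc n))) ⟩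
  sumOf cf (positiveHeaded (suc (suc n))) + sumOf cf (zeroHeaded (suc (suc n)))
    ≡⟨ cong₂ _+_ (cfSum-positiveHeaded (suc n)) (cfSum-zeroHeaded n) ⟩
  (c + s) + ½ * c
    ≡⟨ solve 2 (λ c s → (c :+ s) :+ con ½ :* c := s :+ con (+ 3 / 2) :* c) refl c s ⟩
  s + (+ 3 / 2) * c ∎
  where
  open ≡-Reasoning
  c = tupleCount (suc n)
  s = cfSum (suc n)

tupleCount-closedForm : ∀ k → inv2^ k * tupleCount (suc k) ≡ 1ℚ
tupleCount-closedForm zero    = refl
tupleCount-closedForm (suc k) = begin
  inv2^ (suc k) * tupleCount (suc (suc k))  ≡⟨ cong₂ _*_ (inv2^-suc k) (tupleCount-suc k) ⟩
  (½ * h) * (c + c)                       ≡⟨ solve 2 (λ h c → (con ½ :* h) :* (c :+ c) := h :* c) refl h c ⟩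
  h * c                                     ≡⟨ tupleCount-closedForm k ⟩
  1ℚ                                        ∎
  where
  open ≡-Reasoning
  h = inv2^ k
  c = tupleCount (suc k)

cfSum-closedForm : ∀ k → inv2^ k * cfSum (suc k) ≡ + 3 / 2 - inv2^ (suc k)
cfSum-closedForm zero    = refl
cfSum-closedForm (suc k) = begin
  inv2^ (suc k) * cfSum (suc (suc k))
    ≡⟨ cong₂ _*_ (inv2^-suc k) (cfSum-suc k) ⟩
  (½ * h) * (s + (+ 3 / 2) * c)
    ≡⟨ solve 3 (λ h s c → (con ½ :* h) :* (s :+ con (+ 3 / 2) :* c)
                        := con ½ :* (h :* s) :+ con (+ 3 / 4) :* (h :* c)) refl h s c ⟩
  ½ * (h * s) + (+ 3 / 4) * (h * c)
    ≡⟨ cong₂ (λ x y → ½ * x + (+ 3 / 4) * y) (cfSum-closedForm k) (tupleCount-closedForm k) ⟩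
  ½ * (+ 3 / 2 - h′) + (+ 3 / 4) * 1ℚ
    ≡⟨ solve 1 (λ h′ → con ½ :* (con (+ 3 / 2) :- h′) :+ con (+ 3 / 4) :* con 1ℚ
                     := con (+ 3 / 2) :- con ½ :* h′) refl h′ ⟩
  + 3 / 2 - ½ * h′
    ≡⟨ cong (+ 3 / 2 -_) (sym (inv2^-suc (suc k))) ⟩
  + 3 / 2 - inv2^ (suc (suc k)) ∎
  where
  open ≡-Reasoning
  h  = inv2^ k
  h′ = inv2^ (suc k)
  s  = cfSum (suc k)
  c  = tupleCount (suc k)

corollary2 : ∀ (n : ℕ) → 1 ≤ n →
    inv2^ (n ∸ 1) * cfSum n ≡ (+ 3 / 2) - inv2^ n
corollary2 (suc k) _ = cfSum-closedForm k
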